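{- Let $G$ be a partially-$q$-colored graph with maximum degree $\Delta\ge1$ and $q\ge\Delta+1$, let $v$ be an unpinned vertex of degree $d$ with neighbors ordered as $w_1,\dots,w_d$, and let $i,j\in\Gamma_v$. Then, as an identity of rational functions in the formal variables $\vec\lambda=(\lambda_1,\dots,\lambda_q)$, $$R^{(i,j)}_{G,v}(\vec\lambda)=\frac{\lambda_i}{\lambda_j}\prod_{k=1}^{d}\frac{1-\mathcal P_{G_k^{(i,j)},\vec\lambda}[\sigma(w_k)=i]}{1-\mathcal P_{G_k^{(i,j)},\vec\lambda}[\sigma(w_k)=j]}.$$
   Context: A partially-$q$-colored graph $(G,\tau)$ is a graph $G$ with a map $\tau:V(G)\to[q]\cup\{*\}$ such that for each edge $uv$ either $\tau(u)\ne\tau(v)$ or $\tau(u)=\tau(v)=*$; vertices with $\tau(v)=*$ are unpinned, others are pinned (to color $\tau(v)$), and every pinned vertex has degree $1$. $\mathcal C_G$ denotes the set of proper colorings $\sigma:V(G)\to[q]$ agreeing with $\tau$ on pinned vertices, and $Z_G(\vec\lambda)=\sum_{\sigma\in\mathcal C_G}\prod_{x\in V(G)}\lambda_{\sigma(x)}$. For a vertex $w$ and color $c$, $Z^{(c)}_{G,w}(\vec\lambda)=\sum_{\sigma\in\mathcal C_G,\,\sigma(w)=c}\prod_{x\in V(G)}\lambda_{\sigma(x)}$, the marginal pseudo-probability is $\mathcal P_{G,\vec\lambda}[\sigma(w)=c]=Z^{(c)}_{G,w}(\vec\lambda)/Z_G(\vec\lambda)$, and for $j\in\Gamma_v$ the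 marginal ratio is $R^{(i,j)}_{G,v}=Z^{(i)}_{G,v}/Z^{(j)}_{G,v}$. $\Gamma_v$ (good colors of $v$) is the set of colors different from all colors to which neighbors of $v$ are pinned. For $k\in[d]$, $G_k^{(i,j)}$ is obtained from $G$ by replacing $v$ by $d$ copies $v_1,\dots,v_d$, joining $v_\ell$ to $w_\ell$, pinning $v_1,\dots,v_{k-1}$ to color $i$, pinning $v_{k+1},\dots,v_d$ to color $j$, and deleting $v_k$. -}

module Defs where

open import Level using (Level)
open import Data.Nat as ℕ using (ℕ; zero; suc; pred; _≤_)
open import Data.Nat.Properties using (+-*-commutativeSemiring)
open import Data.Fin as Fin using (Fin; zero; suc; punchIn; punchOut; splitAt; _↑ˡ_; _≟_; _<?_)
open import Data.Bool using (Bool; true; false; _∧_; _∨_; not; if_then_else_)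
open import Data.Maybe using (Maybe; just; nothing)
open import Data.Sum using (_⊎_; inj₁; inj₂)
open import Data.Product using (_×_; ∃; _,_)
open import Data.List using (List; []; _∷_; map; concatMap; filterᵇ; allFin; foldr; length)
open import Relation.Nullary using (¬_)
open import Relation.Nullary.Decidable using (isYes)
open import Relation.Binary.PropositionalEquality using (_≡_; _≢_; refl; trans; sym)
open import Algebra.Bundles using (CommutativeSemiring; CommutativeRing)

Graph : ℕ → Set
Graph n = Fin n → Fin n → Bool

record IsSimple {n : ℕ} (A : Graph n) : Set where
  field
    irrefl : ∀ x → A x x ≡ false
    symm   : ∀ x y → A x y ≡ A y x

deg : {n : ℕ} → Graph n → Fin n → ℕ
deg {n} A x = length (filterᵇ (A x) (allFin n))

MaxDegree : {n : ℕ} → Graph n → ℕ → Set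
MaxDegree A Δ = (∀ x → deg A x ≤ Δ) × ∃ (λ x → deg A x ≡ Δ)

-- τ : V → [q] ∪ {*}, with nothing playing the role of *
Pinning : ℕ → ℕ → Set
Pinning q n = Fin n → Maybe (Fin q)

record IsPartiallyColored {q n : ℕ} (A : Graph n) (τ : Pinning q n) : Set where
  field
    simple : IsSimple A
    edgeOK : ∀ u v → A u v ≡ true →
             (τ u ≢ τ v) ⊎ (τ u ≡ nothing × τ v ≡ nothing)
    pinnedDeg1 : ∀ u c → τ u ≡ just c → deg A u ≡ 1

-- c ∈ Γ_v : c differs from every color to which a neighbor of v is pinned
Good : {q n : ℕ} → Graph n → Pinning q n → Fin n → Fin q → Set
Good A τ v c = ∀ u → A v u ≡ true → τ u ≢ just c

consF : {n q : ℕ} → Fin q → (Fin n → Fin q) → Fin (suc n) → Fin q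
consF c f zero    = c
consF c f (suc x) = f x

allMaps : (n q : ℕ) → List (Fin n → Fin q)
allMaps zero    q = (λ ()) ∷ []
allMaps (suc n) q = concatMap (λ c → map (consF c) (allMaps n q)) (allFin q)

all : {A : Set} → (A → Bool) → List A → Bool
all p = foldr (λ x b → p x ∧ b) true

pinOK : {q : ℕ} → Maybe (Fin q) → Fin q → Bool
pinOK nothing  c = true
pinOK (just d) c = isYes (c ≟ d)

isColoring : {n q : ℕ} → Graph n → Pinning q n → (Fin n → Fin q) → Bool
isColoring {n} A τ σ =
  all (λ x → all (λ y → not (A x y) ∨ not (isYes (σ x ≟ σ y))) (allFin n)) (allFin n)
  ∧ all (λ x → pinOK (τ x) (σ x)) (allFin n)

colorings : {n q : ℕ} → Graph n → Pinning q n → List (Fin n → Fin q)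
colorings {n} {q} A τ = filterᵇ (isColoring A τ) (allMaps n q)

module _ {c ℓ : Level} (S : CommutativeSemiring c ℓ) where
  open CommutativeSemiring S

  Σl : List Carrier → Carrier
  Σl = foldr _+_ 0#

  Πl : List Carrier → Carrier
  Πl = foldr _*_ 1#

  weight : {n q : ℕ} → (Fin q → Carrier) → (Fin n → Fin q) → Carrier
  weight {n} λs σ = Πl (map (λ x → λs (σ x)) (allFin n))

  Z : {n q : ℕ} → Graph n → Pinning q n → (Fin q → Carrier) → Carrier
  Z A τ λs = Σl (map (weight λs) (colorings A τ))

  ZAt : {n q : ℕ} → Graph n → Pinning q n → (Fin q → Carrier) → Fin n → Fin q → Carrier
  ZAt A τ λs w c =
    Σl (map (weight λs) (filterᵇ (λ σ → isYes (σ w ≟ c)) (colorings A τ)))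

ℕS : CommutativeSemiring _ _
ℕS = +-*-commutativeSemiring

ones : {q : ℕ} → Fin q → ℕ
ones _ = 1

-- Vertices of G_k: Fin (pred n + pred d); the first pred n are the vertices of
-- G other than v (via punchIn v), the last pred d are the copies v_ℓ, ℓ ≠ k
-- (via punchIn k).

kind : {n d : ℕ} → Fin n → Fin d → Fin (pred n ℕ.+ pred d) → Fin n ⊎ Fin d
kind {suc m} {suc e} v k a with splitAt m {e} a
... | inj₁ x = inj₁ (punchIn v x)
... | inj₂ l = inj₂ (punchIn k l)

adjKind : {n d : ℕ} → (Fin d → Fin n) → Graph n → Fin n ⊎ Fin d → Fin n ⊎ Fin d → Bool
adjKind w A (inj₁ x) (inj₁ y) = A x y
adjKind w A (inj₁ x) (inj₂ l) = isYes (x ≟ w l)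
adjKind w A (inj₂ l) (inj₁ x) = isYes (x ≟ w l)
adjKind w A (inj₂ l) (inj₂ l') = false

adjGk : {n d : ℕ} → Graph n → Fin n → (Fin d → Fin n) → Fin d → Graph (pred n ℕ.+ pred d)
adjGk A v w k a b = adjKind w A (kind v k a) (kind v k b)

pinKind : {q n d : ℕ} → Pinning q n → Fin d → Fin q → Fin q → Fin n ⊎ Fin d → Maybe (Fin q)
pinKind τ k i j (inj₁ x) = τ x
pinKind τ k i j (inj₂ l) = if isYes (l <? k) then just i else just j

τGk : {q n d : ℕ} → Pinning q n → Fin n → Fin d → Fin q → Fin q → Pinning q (pred n ℕ.+ pred d)
τGk τ v k i j a = pinKind τ k i j (kind v k a)

oldIdx : {n d : ℕ} (v : Fin n) (k : Fin d) (u : Fin n) → v ≢ u → Fin (pred n ℕ.+ pred d)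
oldIdx {suc m} {suc e} v k u neq = punchOut neq ↑ˡ e

nbr≢ : {n : ℕ} {A : Graph n} → IsSimple A → {v u : Fin n} → A v u ≡ true → v ≢ u
nbr≢ s {v} e refl with trans (sym e) (IsSimple.irrefl s v)
... | ()

-- Let Y(β) (ZAvoiding) be the weight of the proper colorings of G − v in which no neighbor w_l
-- gets the color β_l, and let β_t = boundary i j t give w_l the color i for l < t and j for l ≥ t.
-- Fixing the color c of v turns the colorings of G into the colorings of G − v that avoid c at
-- every w_l, so Z^{(i)}_{G,v} = λ_i Y(β_d) and Z^{(j)}_{G,v} = λ_j Y(β_0).  In G_k the copies of v
-- are pinned as β_k prescribes away from w_k, so the colorings of G_k in which w_k avoids j
-- (resp. i) are, up to the weight C_k of the pinned copies, those counted by Y(β_k)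
-- (resp. Y(β_{k+1})).  The product over k therefore telescopes to the cross-multiplied identity.
-- At λ = 1 every Y(β_t) is positive: G − v can be colored greedily, because each vertex has at
-- most Δ < q neighbors and forbidden colors together.

module Submission where

open import Level using (Level)
open import Function using (_∘_; _⇔_; mk⇔; Equivalence; case_of_)
open import Data.Nat as ℕ using (ℕ; zero; suc; _≤_; _<_; z≤n; s≤s)
open import Data.Nat.Properties using (*-identityˡ; m<m+n; ≤-refl; <-irrefl; ≤∧≢⇒<; m<1+n⇒m≤n
  ; m<n⇒m<1+n; ≤-reflexive; ≤-trans; +-monoʳ-≤; +-monoˡ-≤; <⇒≱; m≤m+n; module ≤-Reasoning)
open import Data.Fin as Fin using (Fin; zero; suc; punchIn; punchOut; toℕ; _↑ˡ_; _↑ʳ_; splitAt; _≟_)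
open import Data.Fin.Properties using (toℕ-injective; toℕ<n; any?; injective⇒≤; punchInᵢ≢i
  ; punchIn-punchOut; punchIn-injective; splitAt-↑ˡ; splitAt-↑ʳ; splitAt⁻¹-↑ˡ; splitAt⁻¹-↑ʳ)
open import Data.Vec.Functional as Vector using (Vector; insertAt; _++_; updateAt)
open import Data.Vec.Functional.Properties using (updateAt-updates; updateAt-minimal
  ; insertAt-lookup; insertAt-punchIn; lookup-++ˡ; lookup-++ʳ; ++-cong)
open import Data.Bool using (Bool; true; false; not; if_then_else_; _∧_; _∨_; T)
open import Data.Bool.Properties using (T-∧; T-≡; if-∧; if-float; ∧-zeroʳ; ∧-identityʳ)
open import Function.Properties.Equivalence using () renaming (trans to ⇔-trans; sym to ⇔-sym)
open import Data.Product.Function.NonDependent.Propositional using (_×-⇔_)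
open import Data.Empty using (⊥-elim)
open import Relation.Nullary using (Dec; yes; no; ¬_; ¬?; contradiction)
open import Relation.Nullary.Decidable using (T?; decidable-stable; isYes; toWitness
  ; fromWitness; toWitnessFalse; fromWitnessFalse)
open import Data.Maybe using (just; nothing)
open import Data.Maybe.Properties using (just-injective)
open import Data.Sum using (_⊎_; inj₁; inj₂)
open import Data.Product using (_×_; ∃; _,_; proj₁; proj₂)
open import Data.List as List using (List; []; _∷_; map; allFin; filterᵇ; concatMap; mapMaybe)
open import Data.List.Membership.Propositional using (_∈_; _∉_)
open import Data.List.Relation.Unary.Any as Any using (here)
open import Data.List.Relation.Unary.Any.Properties using (lookup-index; mapMaybe⁺)
import Data.Maybe.Relation.Unary.Any as MaybeAny
open import Data.List.Membership.Propositional.Properties using (∈-allFin; ∈-map⁺; ∈-filter⁺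
  ; ∈-++⁺ˡ; ∈-++⁺ʳ)
open import Data.List.Properties using (map-tabulate; map-∘; map-cong; length-++; length-mapMaybe)
open import Relation.Binary.Core using (_Preserves_⟶_)
open import Relation.Binary.PropositionalEquality as ≡ using (_≡_; _≢_; _≗_)
open import Function.Definitions using (Injective)
import Algebra.Properties.CommutativeMonoid.Sum
open import Algebra.Bundles using (CommutativeMonoid; CommutativeSemiring; CommutativeRing)
open import Defs

-- Finite sums

foldr-tabulate : {a b : Level} {A : Set a} {B : Set b} (_∙_ : A → B → B) (e : B)
                 {n : ℕ} (f : Fin n → A) →
                 List.foldr _∙_ e (List.tabulate f) ≡ Vector.foldr _∙_ e f
foldr-tabulate _∙_ e {zero}  f = ≡.refl
foldr-tabulate _∙_ e {suc n} f = ≡.cong (f zero ∙_) (foldr-tabulate _∙_ e (f ∘ suc))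

foldr-map-allFin : {a b : Level} {A : Set a} {B : Set b} (_∙_ : A → B → B) (e : B)
                   {n : ℕ} (f : Fin n → A) →
                   List.foldr _∙_ e (map f (allFin n)) ≡ Vector.foldr _∙_ e f
foldr-map-allFin _∙_ e f =
  ≡.trans (≡.cong (List.foldr _∙_ e) (map-tabulate (λ x → x) f)) (foldr-tabulate _∙_ e f)

module _ {c ℓ : Level} (M : CommutativeMonoid c ℓ) where
  open CommutativeMonoid M
  open import Algebra.Properties.CommutativeMonoid.Sum M using (sum)
  open import Algebra.Properties.CommutativeSemigroup commutativeSemigroup using (x∙yz≈y∙xz)

  sum-↑ : ∀ m {e} (f : Vector Carrier (m ℕ.+ e)) →
          sum f ≈ sum (f ∘ (_↑ˡ e)) ∙ sum (f ∘ (m ↑ʳ_))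
  sum-↑ zero    f = sym (identityˡ _)
  sum-↑ (suc m) f = trans (∙-congˡ (sum-↑ m (f ∘ suc))) (sym (assoc _ _ _))

  sum-telescope : ∀ d (f : ℕ → Carrier) →
                  f d ∙ sum (λ k → f (toℕ {d} k)) ≈ f 0 ∙ sum (λ k → f (suc (toℕ {d} k)))
  sum-telescope zero    f = refl
  sum-telescope (suc d) f = begin
    f (suc d) ∙ (f 0 ∙ sum (λ k → f (suc (toℕ {d} k))))
      ≈⟨ x∙yz≈y∙xz _ _ _ ⟩
    f 0 ∙ (f (suc d) ∙ sum (λ k → f (suc (toℕ {d} k))))
      ≈⟨ ∙-congˡ (sum-telescope d (f ∘ suc)) ⟩
    f 0 ∙ (f 1 ∙ sum (λ k → f (suc (suc (toℕ {d} k)))))   ∎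
    where open import Relation.Binary.Reasoning.Setoid setoid

module Sums {c ℓ : Level} (S : CommutativeSemiring c ℓ) where
  open CommutativeSemiring S hiding (zero)
  open import Algebra.Properties.Semiring.Sum semiring public
  open import Relation.Binary.Reasoning.Setoid setoid

  Σl-++ : {A : Set} (f : A → Carrier) (xs ys : List A) →
          Σl S (map f (xs List.++ ys)) ≈ Σl S (map f xs) + Σl S (map f ys)
  Σl-++ f []       ys = sym (+-identityˡ _)
  Σl-++ f (x ∷ xs) ys = trans (+-congˡ (Σl-++ f xs ys)) (sym (+-assoc _ _ _))

  Σl-concatMap : {A B : Set} (f : B → Carrier) (g : A → List B) (xs : List A) →
                 Σl S (map f (concatMap g xs)) ≈ Σl S (map (λ x → Σl S (map f (g x))) xs)
  Σl-concatMap f g []       = refl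
  Σl-concatMap f g (x ∷ xs) = trans (Σl-++ f (g x) (concatMap g xs)) (+-congˡ (Σl-concatMap f g xs))

  Σl-filterᵇ : {A : Set} (f : A → Carrier) (p : A → Bool) (xs : List A) →
               Σl S (map f (filterᵇ p xs)) ≈ Σl S (map (λ x → if p x then f x else 0#) xs)
  Σl-filterᵇ f p []       = refl
  Σl-filterᵇ f p (x ∷ xs) with p x
  ... | true  = +-congˡ (Σl-filterᵇ f p xs)
  ... | false = trans (Σl-filterᵇ f p xs) (sym (+-identityˡ _))

  Σl-partition : {A : Set} (f : A → Carrier) (p : A → Bool) (xs : List A) →
                 Σl S (map f xs) ≈ Σl S (map f (filterᵇ p xs)) + Σl S (map f (filterᵇ (not ∘ p) xs))
  Σl-partition f p []       = sym (+-identityˡ 0#)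
  Σl-partition f p (x ∷ xs) with p x
  ... | true  = trans (+-congˡ (Σl-partition f p xs)) (sym (+-assoc _ _ _))
  ... | false = trans (+-congˡ (Σl-partition f p xs)) (x∙yz≈y∙xz _ _ _)
    where open import Algebra.Properties.CommutativeSemigroup +-commutativeSemigroup using (x∙yz≈y∙xz)

  module ∏ = Algebra.Properties.CommutativeMonoid.Sum *-commutativeMonoid
  open ∏ public using () renaming (sum to product)

  if-*ˡ : ∀ b {a x y} → x ≈ a * y → (if b then x else 0#) ≈ a * (if b then y else 0#)
  if-*ˡ true      x≈ay = x≈ay
  if-*ˡ false {a} _    = sym (zeroʳ a)

  Σl-allFin : {n : ℕ} (f : Fin n → Carrier) → Σl S (map f (allFin n)) ≡ sum f
  Σl-allFin = foldr-map-allFin _+_ 0#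

  Πl-allFin : {n : ℕ} (f : Fin n → Carrier) → Πl S (map f (allFin n)) ≡ product f
  Πl-allFin = foldr-map-allFin _*_ 1#

  sum-supported : {n : ℕ} (g : Vector Carrier n) (i : Fin n) →
                  (∀ c → c ≢ i → g c ≈ 0#) → sum g ≈ g i
  sum-supported {suc n} g i g≈0 = begin
    sum g                                ≈⟨ sum-remove {i = i} g ⟩
    g i + sum (g ∘ punchIn i)            ≈⟨ +-congˡ (sum-cong-≋ {n} (g≈0 _ ∘ punchInᵢ≢i i)) ⟩
    g i + sum (Vector.replicate n 0#)    ≈⟨ +-congˡ (sum-replicate-zero n) ⟩
    g i + 0#                             ≈⟨ +-identityʳ _ ⟩
    g i                                  ∎

  module _ {q : ℕ} where

    sumMaps : (n : ℕ) → ((Fin n → Fin q) → Carrier) → Carrier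
    sumMaps zero    f = f (λ ())
    sumMaps (suc n) f = ∑[ c < q ] sumMaps n (f ∘ consF c)

    sumMaps-cong : ∀ n {f g : (Fin n → Fin q) → Carrier} → (∀ σ → f σ ≈ g σ) →
                   sumMaps n f ≈ sumMaps n g
    sumMaps-cong zero    f≈g = f≈g _
    sumMaps-cong (suc n) f≈g = sum-cong-≋ {q} (λ c → sumMaps-cong n (f≈g ∘ consF c))

    sumMaps-zero : ∀ n {f : (Fin n → Fin q) → Carrier} → (∀ σ → f σ ≈ 0#) → sumMaps n f ≈ 0#
    sumMaps-zero zero    f≈0 = f≈0 _
    sumMaps-zero (suc n) f≈0 =
      trans (sum-cong-≋ {q} (λ c → sumMaps-zero n (f≈0 ∘ consF c))) (sum-replicate-zero q)

    *-distribˡ-sumMaps : ∀ a n (f : (Fin n → Fin q) → Carrier) →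
                         a * sumMaps n f ≈ sumMaps n (λ σ → a * f σ)
    *-distribˡ-sumMaps a zero    f = refl
    *-distribˡ-sumMaps a (suc n) f =
      trans (*-distribˡ-sum {q} a _) (sum-cong-≋ {q} (λ c → *-distribˡ-sumMaps a n (f ∘ consF c)))

    Σl-allMaps : ∀ n (f : (Fin n → Fin q) → Carrier) → Σl S (map f (allMaps n q)) ≈ sumMaps n f
    Σl-allMaps zero    f = +-identityʳ _
    Σl-allMaps (suc n) f = begin
      Σl S (map f (allMaps (suc n) q))
        ≈⟨ Σl-concatMap f (λ c → map (consF c) (allMaps n q)) (allFin q) ⟩
      Σl S (map (λ c → Σl S (map f (map (consF c) (allMaps n q)))) (allFin q))
        ≡⟨ Σl-allFin {q} _ ⟩
      ∑[ c < q ] Σl S (map f (map (consF c) (allMaps n q)))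
        ≈⟨ sum-cong-≋ {q} (λ c → trans (reflexive (≡.cong (Σl S) (≡.sym (map-∘ (allMaps n q)))))
                                   (Σl-allMaps n (f ∘ consF c))) ⟩
      sumMaps (suc n) f ∎

    consF-cong : ∀ {n} (c : Fin q) {σ σ′ : Fin n → Fin q} → σ ≗ σ′ → consF c σ ≗ consF c σ′
    consF-cong c σ≗σ′ zero    = ≡.refl
    consF-cong c σ≗σ′ (suc x) = σ≗σ′ x

    sumMaps-insertAt : ∀ {m} (v : Fin (suc m)) {f : (Fin (suc m) → Fin q) → Carrier} →
                       f Preserves _≗_ ⟶ _≈_ →
                       sumMaps (suc m) f ≈ ∑[ c < q ] sumMaps m (λ σ → f (insertAt σ v c))
    sumMaps-insertAt {m} zero f-cong =
      sum-cong-≋ {q} (λ c → sumMaps-cong m (λ σ → f-cong {consF c σ} {insertAt σ zero c}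
        (λ { zero → ≡.refl ; (suc x) → ≡.refl })))
    sumMaps-insertAt {suc m} (suc v) {f} f-cong = begin
      ∑[ a < q ] sumMaps (suc m) (f ∘ consF a)
        ≈⟨ sum-cong-≋ {q} (λ a → sumMaps-insertAt v (f-cong ∘ consF-cong a)) ⟩
      ∑[ a < q ] ∑[ c < q ] sumMaps m (λ σ → f (consF a (insertAt σ v c)))
        ≈⟨ ∑-comm (λ a c → sumMaps m (λ σ → f (consF a (insertAt σ v c)))) ⟩
      ∑[ c < q ] ∑[ a < q ] sumMaps m (λ σ → f (consF a (insertAt σ v c)))
        ≈⟨ sum-cong-≋ {q} (λ c → sum-cong-≋ {q} (λ a → sumMaps-cong m (λ σ →
             f-cong {consF a (insertAt σ v c)} {insertAt (consF a σ) (suc v) c}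
               (λ { zero → ≡.refl ; (suc x) → ≡.refl })))) ⟩
      ∑[ c < q ] sumMaps (suc m) (λ σ → f (insertAt σ (suc v) c)) ∎

    sumMaps-fix : ∀ {m} (v : Fin (suc m)) (c : Fin q) {f : (Fin (suc m) → Fin q) → Carrier} →
                  f Preserves _≗_ ⟶ _≈_ → (∀ σ → σ v ≢ c → f σ ≈ 0#) →
                  sumMaps (suc m) f ≈ sumMaps m (λ σ → f (insertAt σ v c))
    sumMaps-fix {m} v c f-cong f≈0 = trans (sumMaps-insertAt v f-cong) (sum-supported _ c λ c′ c′≢c →
      sumMaps-zero m λ σ → f≈0 _ (c′≢c ∘ ≡.trans (≡.sym (insertAt-lookup σ v c′))))

    sumMaps-++ : ∀ m {e} {f : (Fin (m ℕ.+ e) → Fin q) → Carrier} → f Preserves _≗_ ⟶ _≈_ →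
                 sumMaps (m ℕ.+ e) f ≈ sumMaps m (λ σ₁ → sumMaps e (λ σ₂ → f (σ₁ ++ σ₂)))
    sumMaps-++ zero    f-cong = refl
    sumMaps-++ (suc m) f-cong = sum-cong-≋ {q} (λ c → trans (sumMaps-++ m (f-cong ∘ consF-cong c))
      (sumMaps-cong m (λ σ₁ → sumMaps-cong _ (λ σ₂ → f-cong (consF-++ c σ₁ σ₂)))))
      where
      consF-++ : ∀ {e} (c : Fin q) (σ₁ : Fin m → Fin q) (σ₂ : Fin e → Fin q) →
                 consF c (σ₁ ++ σ₂) ≗ consF c σ₁ ++ σ₂
      consF-++ c σ₁ σ₂ zero = ≡.refl
      consF-++ c σ₁ σ₂ (suc x) with splitAt m x
      ... | inj₁ _ = ≡.refl
      ... | inj₂ _ = ≡.refl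

    sumMaps-pin : ∀ e (π : Fin e → Fin q) {f : (Fin e → Fin q) → Carrier} →
                  f Preserves _≗_ ⟶ _≈_ → (∀ σ l → σ l ≢ π l → f σ ≈ 0#) → sumMaps e f ≈ f π
    sumMaps-pin zero    π f-cong f≈0 = f-cong (λ ())
    sumMaps-pin (suc e) π {f} f-cong f≈0 = begin
      ∑[ c < q ] sumMaps e (f ∘ consF c)
        ≈⟨ sum-supported _ (π zero) (λ c c≢π₀ → sumMaps-zero e (λ σ → f≈0 _ zero c≢π₀)) ⟩
      sumMaps e (f ∘ consF (π zero))
        ≈⟨ sumMaps-pin e (π ∘ suc) (f-cong ∘ consF-cong (π zero)) (λ σ l → f≈0 _ (suc l)) ⟩
      f (consF (π zero) (π ∘ suc))
        ≈⟨ f-cong {consF (π zero) (π ∘ suc)} {π} (λ { zero → ≡.refl ; (suc l) → ≡.refl }) ⟩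
      f π ∎

  module _ {q : ℕ} (λs : Fin q → Carrier) where

    weight≡product : ∀ {n} (σ : Fin n → Fin q) → weight S λs σ ≡ product (λs ∘ σ)
    weight≡product σ = foldr-map-allFin _*_ 1# (λs ∘ σ)

    weight-cong : ∀ {n} {σ σ′ : Fin n → Fin q} → σ ≗ σ′ → weight S λs σ ≡ weight S λs σ′
    weight-cong σ≗σ′ = ≡.cong (Πl S) (map-cong (≡.cong λs ∘ σ≗σ′) (allFin _))

    weightIf : ∀ {n} → ((Fin n → Fin q) → Bool) → (Fin n → Fin q) → Carrier
    weightIf p σ = if p σ then weight S λs σ else 0#

    weightIf-cong : ∀ {n} (p : (Fin n → Fin q) → Bool) →
                    (∀ {σ σ′} → σ ≗ σ′ → p σ ≡ p σ′) → weightIf p Preserves _≗_ ⟶ _≈_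
    weightIf-cong p p-cong σ≗σ′ =
      reflexive (≡.cong₂ (λ b x → if b then x else 0#) (p-cong σ≗σ′) (weight-cong σ≗σ′))

    weightIf-false : ∀ {n} (p : (Fin n → Fin q) → Bool) {σ} → p σ ≡ false → weightIf p σ ≈ 0#
    weightIf-false p pσ≡false = reflexive (≡.cong (λ b → if b then _ else 0#) pσ≡false)

    weight-insertAt : ∀ {m} (σ : Fin m → Fin q) (v : Fin (suc m)) (c : Fin q) →
                      weight S λs (insertAt σ v c) ≈ λs c * weight S λs σ
    weight-insertAt σ v c = begin
      weight S λs (insertAt σ v c)
        ≡⟨ weight≡product (insertAt σ v c) ⟩
      product (λs ∘ insertAt σ v c)
        ≈⟨ ∏.sum-remove {i = v} (λs ∘ insertAt σ v c) ⟩
      λs (insertAt σ v c v) * product (λs ∘ insertAt σ v c ∘ punchIn v)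
        ≡⟨ ≡.cong₂ _*_ (≡.cong λs (insertAt-lookup σ v c))
                       (∏.sum-cong-≗ (≡.cong λs ∘ insertAt-punchIn σ v c)) ⟩
      λs c * product (λs ∘ σ)
        ≡⟨ ≡.cong (λs c *_) (weight≡product σ) ⟨
      λs c * weight S λs σ ∎

    weight-++ : ∀ {m e} (σ₁ : Fin m → Fin q) (σ₂ : Fin e → Fin q) →
                weight S λs (σ₁ ++ σ₂) ≈ weight S λs σ₁ * weight S λs σ₂
    weight-++ {m} {e} σ₁ σ₂ = begin
      weight S λs (σ₁ ++ σ₂)
        ≡⟨ weight≡product (σ₁ ++ σ₂) ⟩
      product (λs ∘ (σ₁ ++ σ₂))
        ≈⟨ sum-↑ *-commutativeMonoid m (λs ∘ (σ₁ ++ σ₂)) ⟩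
      product (λs ∘ (σ₁ ++ σ₂) ∘ (_↑ˡ e)) * product (λs ∘ (σ₁ ++ σ₂) ∘ (m ↑ʳ_))
        ≡⟨ ≡.cong₂ _*_ (∏.sum-cong-≗ (≡.cong λs ∘ lookup-++ˡ σ₁ σ₂))
                       (∏.sum-cong-≗ (≡.cong λs ∘ lookup-++ʳ σ₁ σ₂)) ⟩
      product (λs ∘ σ₁) * product (λs ∘ σ₂)
        ≡⟨ ≡.cong₂ _*_ (weight≡product σ₁) (weight≡product σ₂) ⟨
      weight S λs σ₁ * weight S λs σ₂ ∎

-- Colorings as propositions

T-injective : ∀ {x y} → T x ⇔ T y → x ≡ y
T-injective {false} {false} _   = ≡.refl
T-injective {false} {true}  x⇔y = ⊥-elim (Equivalence.from x⇔y _)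
T-injective {true}  {false} x⇔y = ⊥-elim (Equivalence.to x⇔y _)
T-injective {true}  {true}  _   = ≡.refl

T-all-tabulate : {A : Set} (p : A → Bool) {n : ℕ} (f : Fin n → A) →
                 T (all p (List.tabulate f)) ⇔ (∀ x → T (p (f x)))
T-all-tabulate p {zero}  f = mk⇔ (λ _ ()) _
T-all-tabulate p {suc n} f = mk⇔
  (λ t → let t₀ , t₊ = Equivalence.to T-∧ t in
         λ { zero → t₀ ; (suc x) → Equivalence.to IH t₊ x })
  (λ h → Equivalence.from T-∧ (h zero , Equivalence.from IH (h ∘ suc)))
  where IH = T-all-tabulate p (f ∘ suc)

T-all-allFin : {n : ℕ} (p : Fin n → Bool) → T (all p (allFin n)) ⇔ (∀ x → T (p x))
T-all-allFin p = T-all-tabulate p (λ x → x)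

all-cong : {A : Set} {p p′ : A → Bool} → (∀ x → p x ≡ p′ x) → ∀ xs → all p xs ≡ all p′ xs
all-cong p≡p′ []       = ≡.refl
all-cong p≡p′ (x ∷ xs) = ≡.cong₂ _∧_ (p≡p′ x) (all-cong p≡p′ xs)

module _ {n q : ℕ} where

  IsProper : Graph n → (Fin n → Fin q) → Set
  IsProper A σ = ∀ x y → A x y ≡ true → σ x ≢ σ y

  Agrees : Pinning q n → (Fin n → Fin q) → Set
  Agrees τ σ = ∀ x c → τ x ≡ just c → σ x ≡ c

  T-isColoring : (A : Graph n) (τ : Pinning q n) (σ : Fin n → Fin q) →
                 T (isColoring A τ σ) ⇔ (IsProper A σ × Agrees τ σ)
  T-isColoring A τ σ = ⇔-trans T-∧ (T-proper ×-⇔ T-agrees)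
    where
    T-edge : ∀ b {a a′ : Fin q} → T (not b ∨ not (isYes (a ≟ a′))) ⇔ (b ≡ true → a ≢ a′)
    T-edge false = mk⇔ (λ _ ()) _
    T-edge true  = mk⇔ (λ t _ → toWitnessFalse t) (λ h → fromWitnessFalse (h ≡.refl))
    T-pinOK : ∀ ρ {a : Fin q} → T (pinOK ρ a) ⇔ (∀ c → ρ ≡ just c → a ≡ c)
    T-pinOK nothing  = mk⇔ (λ _ _ ()) _
    T-pinOK (just c) = mk⇔ (λ t → λ { _ ≡.refl → toWitness t }) (λ h → fromWitness (h c ≡.refl))
    edgesOK : Fin n → Bool
    edgesOK x = all (λ y → not (A x y) ∨ not (isYes (σ x ≟ σ y))) (allFin n)
    T-proper : T (all edgesOK (allFin n)) ⇔ IsProper A σ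
    T-proper = mk⇔
      (λ t x y → Equivalence.to (T-edge (A x y))
                   (Equivalence.to (T-all-allFin _) (Equivalence.to (T-all-allFin edgesOK) t x) y))
      (λ proper → Equivalence.from (T-all-allFin edgesOK) (λ x → Equivalence.from (T-all-allFin _)
                   (λ y → Equivalence.from (T-edge (A x y)) (proper x y))))
    T-agrees : T (all (λ x → pinOK (τ x) (σ x)) (allFin n)) ⇔ Agrees τ σ
    T-agrees = mk⇔
      (λ t x → Equivalence.to (T-pinOK (τ x)) (Equivalence.to (T-all-allFin _) t x))
      (λ agrees → Equivalence.from (T-all-allFin _) (λ x → Equivalence.from (T-pinOK (τ x)) (agrees x)))

  isColoring-cong : (A : Graph n) (τ : Pinning q n) {σ σ′ : Fin n → Fin q} → σ ≗ σ′ →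
                    isColoring A τ σ ≡ isColoring A τ σ′
  isColoring-cong A τ σ≗σ′ = ≡.cong₂ _∧_
    (all-cong (λ x → all-cong (λ y →
       ≡.cong₂ (λ a b → not (A x y) ∨ not (isYes (a ≟ b))) (σ≗σ′ x) (σ≗σ′ y)) (allFin n)) (allFin n))
    (all-cong (λ x → ≡.cong (pinOK (τ x)) (σ≗σ′ x)) (allFin n))

isYes-true : {p : Level} {P : Set p} (p? : Dec P) → P → isYes p? ≡ true
isYes-true (yes _) _ = ≡.refl
isYes-true (no ¬p) p = ⊥-elim (¬p p)

isYes-false : {p : Level} {P : Set p} (p? : Dec P) → ¬ P → isYes p? ≡ false
isYes-false (yes p) ¬p = ⊥-elim (¬p p)
isYes-false (no _)  _  = ≡.refl

module ColoringSums {c ℓ : Level} (S : CommutativeSemiring c ℓ) {n q : ℕ}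
                    (A : Graph n) (τ : Pinning q n) (λs : Fin q → CommutativeSemiring.Carrier S) where
  open CommutativeSemiring S hiding (zero)
  open Sums S
  open import Relation.Binary.Reasoning.Setoid setoid

  Σl-colorings : (p : (Fin n → Fin q) → Bool) →
                 Σl S (map (weight S λs) (filterᵇ p (colorings A τ))) ≈
                 sumMaps n (weightIf λs (λ σ → isColoring A τ σ ∧ p σ))
  Σl-colorings p = begin
    Σl S (map (weight S λs) (filterᵇ p (colorings A τ)))
      ≈⟨ Σl-filterᵇ (weight S λs) p (colorings A τ) ⟩
    Σl S (map (λ σ → if p σ then weight S λs σ else 0#) (colorings A τ))
      ≈⟨ Σl-filterᵇ _ (isColoring A τ) (allMaps n q) ⟩
    Σl S (map (λ σ → if isColoring A τ σ then (if p σ then weight S λs σ else 0#) else 0#) (allMaps n q))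
      ≈⟨ Σl-allMaps n _ ⟩
    sumMaps n (λ σ → if isColoring A τ σ then (if p σ then weight S λs σ else 0#) else 0#)
      ≈⟨ sumMaps-cong n (λ σ → reflexive (≡.sym (if-∧ (isColoring A τ σ)))) ⟩
    sumMaps n (weightIf λs (λ σ → isColoring A τ σ ∧ p σ)) ∎

  Z≈ZAt+sumMaps : ∀ u a → Z S A τ λs ≈ ZAt S A τ λs u a +
                  sumMaps n (weightIf λs (λ σ → isColoring A τ σ ∧ not (isYes (σ u ≟ a))))
  Z≈ZAt+sumMaps u a = trans (Σl-partition (weight S λs) (λ σ → isYes (σ u ≟ a)) (colorings A τ))
                            (+-congˡ (Σl-colorings (λ σ → not (isYes (σ u ≟ a)))))

-- Counting colorings

module Counting where
  open Sums ℕS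

  length-filterᵇ-tabulate : {A : Set} (p : A → Bool) {n : ℕ} (f : Fin n → A) →
                            List.length (filterᵇ p (List.tabulate f)) ≡
                            sum (λ y → if p (f y) then 1 else 0)
  length-filterᵇ-tabulate p {zero}  f = ≡.refl
  length-filterᵇ-tabulate p {suc n} f with p (f zero)
  ... | true  = ≡.cong suc (length-filterᵇ-tabulate p (f ∘ suc))
  ... | false = length-filterᵇ-tabulate p (f ∘ suc)

  deg≡sum : ∀ {n} (A : Graph n) x → deg A x ≡ sum (λ y → if A x y then 1 else 0)
  deg≡sum A x = length-filterᵇ-tabulate (A x) (λ y → y)

  term≤sum : ∀ {n} (g : Vector ℕ n) i → g i ≤ sum g
  term≤sum {suc n} g i = ≤-trans (m≤m+n (g i) _) (≤-reflexive (≡.sym (sum-remove {i = i} g)))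

  term≤sumMaps : ∀ {q} n {f : (Fin n → Fin q) → ℕ} → f Preserves _≗_ ⟶ _≡_ →
                 ∀ σ → f σ ≤ sumMaps n f
  term≤sumMaps zero    f-cong σ = ≤-reflexive (f-cong (λ ()))
  term≤sumMaps (suc n) {f} f-cong σ = begin
    f σ                             ≡⟨ f-cong {σ} {consF (σ zero) (σ ∘ suc)}
                                               (λ { zero → ≡.refl ; (suc x) → ≡.refl }) ⟩
    f (consF (σ zero) (σ ∘ suc))    ≤⟨ term≤sumMaps n (f-cong ∘ consF-cong (σ zero)) (σ ∘ suc) ⟩
    sumMaps n (f ∘ consF (σ zero))  ≤⟨ term≤sum _ (σ zero) ⟩
    sumMaps (suc n) f               ∎
    where open ≤-Reasoning

  weight-ones : ∀ {n q} (σ : Fin n → Fin q) → weight ℕS ones σ ≡ 1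
  weight-ones {n} σ = ≡.trans (weight≡product ones σ) (∏.sum-replicate-zero n)

open Counting

-- Greedy coloring

module _ {q : ℕ} where
  open import Data.List.Membership.DecPropositional (_≟_ {q}) using (_∈?_)

  ∃∉ : (xs : List (Fin q)) → List.length xs < q → ∃ (_∉ xs)
  ∃∉ xs |xs|<q with any? (λ c → ¬? (c ∈? xs))
  ... | yes c∉xs = c∉xs
  ... | no ∄c∉xs = contradiction (injective⇒≤ index-injective) (<⇒≱ |xs|<q)
    where
    ∈xs : ∀ c → c ∈ xs
    ∈xs c = decidable-stable (c ∈? xs) (λ c∉xs → ∄c∉xs (c , c∉xs))
    index-injective : Injective _≡_ _≡_ (λ c → Any.index (∈xs c))
    index-injective {c} {c′} same-index = ≡.trans (lookup-index (∈xs c))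
      (≡.trans (≡.cong (List.lookup xs) same-index) (≡.sym (lookup-index (∈xs c′))))

module GreedyColoring {N q : ℕ} (B : Graph N) (B-simple : IsSimple B)
                      (forbidden : Fin N → List (Fin q)) where

  Consistent : Pinning q N → Set
  Consistent ρ = (∀ x y a b → B x y ≡ true → ρ x ≡ just a → ρ y ≡ just b → a ≢ b)
               × (∀ x a → ρ x ≡ just a → a ∉ forbidden x)

  HasRoom : Pinning q N → Set
  HasRoom ρ = ∀ x → ρ x ≡ nothing → List.length (forbidden x) ℕ.+ deg B x < q

  usedColors : Pinning q N → Fin N → List (Fin q)
  usedColors ρ x = mapMaybe ρ (filterᵇ (B x) (allFin N))

  ∈-usedColors : ∀ ρ x y {a} → B x y ≡ true → ρ y ≡ just a → a ∈ usedColors ρ x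
  ∈-usedColors ρ x y xy ρy≡a = mapMaybe⁺ ρ (filterᵇ (B x) (allFin N))
    (Any.map (λ ρy≡ρz → ≡.subst (MaybeAny.Any _) (≡.trans (≡.sym ρy≡a) ρy≡ρz)
                                (MaybeAny.just ≡.refl))
             (∈-map⁺ ρ (∈-filter⁺ (T? ∘ B x) (∈-allFin y) (Equivalence.from T-≡ xy))))

  _[_↦_] : Pinning q N → Fin N → Fin q → Pinning q N
  ρ [ x ↦ c ] = updateAt ρ x (λ _ → just c)

  fresh-color-consistent : ∀ ρ x c → Consistent ρ → c ∉ forbidden x List.++ usedColors ρ x →
                           Consistent (ρ [ x ↦ c ])
  fresh-color-consistent ρ x c (proper , allowed) c∉F = proper′ , allowed′
    where
    colored-after : ∀ y {a} → (ρ [ x ↦ c ]) y ≡ just a →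
                    (y ≡ x × a ≡ c) ⊎ (y ≢ x × ρ y ≡ just a)
    colored-after y ρ′y≡a with y ≟ x
    ... | yes ≡.refl = inj₁ (≡.refl , just-injective (≡.trans (≡.sym ρ′y≡a) (updateAt-updates x ρ)))
    ... | no y≢x     = inj₂ (y≢x , ≡.trans (≡.sym (updateAt-minimal y x ρ y≢x)) ρ′y≡a)
    c-unused : ∀ y {b} → B x y ≡ true → ρ y ≡ just b → c ≢ b
    c-unused y xy ρy≡b ≡.refl = c∉F (∈-++⁺ʳ (forbidden x) (∈-usedColors ρ x y xy ρy≡b))
    proper′ : ∀ y z a b → B y z ≡ true →
              (ρ [ x ↦ c ]) y ≡ just a → (ρ [ x ↦ c ]) z ≡ just b → a ≢ b
    proper′ y z a b yz ρ′y ρ′z with colored-after y ρ′y | colored-after z ρ′z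
    ... | inj₁ (≡.refl , ≡.refl) | inj₁ (≡.refl , _)      = λ _ → nbr≢ B-simple yz ≡.refl
    ... | inj₁ (≡.refl , ≡.refl) | inj₂ (_ , ρz≡b)        = c-unused z yz ρz≡b
    ... | inj₂ (_ , ρy≡a)        | inj₁ (≡.refl , ≡.refl) =
      λ a≡c → c-unused y (≡.trans (IsSimple.symm B-simple x y) yz) ρy≡a (≡.sym a≡c)
    ... | inj₂ (_ , ρy≡a)        | inj₂ (_ , ρz≡b)        = proper y z a b yz ρy≡a ρz≡b
    allowed′ : ∀ y a → (ρ [ x ↦ c ]) y ≡ just a → a ∉ forbidden y
    allowed′ y a ρ′y with colored-after y ρ′y
    ... | inj₁ (≡.refl , ≡.refl) = c∉F ∘ ∈-++⁺ˡ
    ... | inj₂ (_ , ρy≡a)        = allowed y a ρy≡a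

  color-vertex : ∀ ρ x → Consistent ρ → HasRoom ρ → ρ x ≡ nothing →
                 ∃ λ c → Consistent (ρ [ x ↦ c ])
  color-vertex ρ x consistent room ρx≡nothing =
    let c , c∉F = ∃∉ (forbidden x List.++ usedColors ρ x) (begin-strict
          List.length (forbidden x List.++ usedColors ρ x)
            ≡⟨ length-++ (forbidden x) ⟩
          List.length (forbidden x) ℕ.+ List.length (usedColors ρ x)
            ≤⟨ +-monoʳ-≤ (List.length (forbidden x)) (length-mapMaybe ρ (filterᵇ (B x) (allFin N))) ⟩
          List.length (forbidden x) ℕ.+ deg B x
            <⟨ room x ρx≡nothing ⟩
          q ∎)
    in c , fresh-color-consistent ρ x c consistent c∉F
    where open ≤-Reasoning

  uncolored-after : ∀ ρ x c y → (ρ [ x ↦ c ]) y ≡ nothing → y ≢ x × ρ y ≡ nothing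
  uncolored-after ρ x c y ρ′y≡nothing with y ≟ x
  ... | yes ≡.refl = case ≡.trans (≡.sym (updateAt-updates x ρ)) ρ′y≡nothing of λ ()
  ... | no y≢x     = y≢x , ≡.trans (≡.sym (updateAt-minimal y x ρ y≢x)) ρ′y≡nothing

  agrees-before : ∀ ρ x c {σ} → ρ x ≡ nothing → Agrees (ρ [ x ↦ c ]) σ → Agrees ρ σ
  agrees-before ρ x c ρx≡nothing agrees y a ρy≡a =
    agrees y a (≡.trans (updateAt-minimal y x ρ y≢x) ρy≡a)
    where
    y≢x : y ≢ x
    y≢x ≡.refl = case ≡.trans (≡.sym ρx≡nothing) ρy≡a of λ ()

  greedy : ∀ xs ρ → Consistent ρ → HasRoom ρ → (∀ x → ρ x ≡ nothing → x ∈ xs) →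
           ∃ λ σ → IsProper B σ × Agrees ρ σ × (∀ x → σ x ∉ forbidden x)
  greedy [] ρ (proper , allowed) _ uncolored = σ , proper′ , agrees , allowed′
    where
    color : ∀ x → ∃ λ a → ρ x ≡ just a
    color x with ρ x in ρx
    ... | just a  = a , ≡.refl
    ... | nothing = case uncolored x ρx of λ ()
    σ : Fin N → Fin q
    σ = proj₁ ∘ color
    proper′ : IsProper B σ
    proper′ x y xy = proper x y _ _ xy (proj₂ (color x)) (proj₂ (color y))
    agrees : Agrees ρ σ
    agrees x a ρx≡a = just-injective (≡.trans (≡.sym (proj₂ (color x))) ρx≡a)
    allowed′ : ∀ x → σ x ∉ forbidden x
    allowed′ x = allowed x (σ x) (proj₂ (color x))
  greedy (x ∷ xs) ρ consistent room uncolored with ρ x in ρx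
  ... | just _  = greedy xs ρ consistent room λ y ρy≡nothing →
    Any.tail (λ { ≡.refl → case ≡.trans (≡.sym ρx) ρy≡nothing of λ () }) (uncolored y ρy≡nothing)
  ... | nothing with color-vertex ρ x consistent room ρx
  ... | c , consistent′ with greedy xs (ρ [ x ↦ c ]) consistent′
        (λ y ρ′y≡nothing → room y (proj₂ (uncolored-after ρ x c y ρ′y≡nothing)))
        (λ y ρ′y≡nothing → let y≢x , ρy≡nothing = uncolored-after ρ x c y ρ′y≡nothing in
                           Any.tail y≢x (uncolored y ρy≡nothing))
  ... | σ , proper , agrees , allowed = σ , proper , agrees-before ρ x c ρx agrees , allowed

-- Deleting v

data PunchInView {m : ℕ} (v : Fin (suc m)) : Fin (suc m) → Set where
  at  : PunchInView v v
  off : (x : Fin m) → PunchInView v (punchIn v x)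

punchInView : ∀ {m} (v x : Fin (suc m)) → PunchInView v x
punchInView v x with v ≟ x
... | yes ≡.refl = at
... | no v≢x     = ≡.subst (PunchInView v) (punchIn-punchOut v≢x) (off (punchOut v≢x))

module Deletion {m q d : ℕ} (A : Graph (suc m)) (τ : Pinning q (suc m)) (simple : IsSimple A)
                (v : Fin (suc m)) (τv : τ v ≡ nothing)
                (w : Fin d → Fin (suc m)) (nb : ∀ l → A v (w l) ≡ true)
                (onto : ∀ u → A v u ≡ true → ∃ λ l → w l ≡ u) where

  A⁻ : Graph m
  A⁻ x y = A (punchIn v x) (punchIn v y)

  τ⁻ : Pinning q m
  τ⁻ = τ ∘ punchIn v

  w⁻ : Fin d → Fin m
  w⁻ l = punchOut (nbr≢ simple (nb l))

  punchIn-w⁻ : ∀ l → punchIn v (w⁻ l) ≡ w l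
  punchIn-w⁻ l = punchIn-punchOut (nbr≢ simple (nb l))

  neighbor⁻ : ∀ x → A v (punchIn v x) ≡ true → ∃ λ l → w⁻ l ≡ x
  neighbor⁻ x vx = let l , wl≡x = onto _ vx in
                    l , punchIn-injective v _ _ (≡.trans (punchIn-w⁻ l) wl≡x)

  Avoids : (Fin d → Fin q) → (Fin m → Fin q) → Set
  Avoids β σ = ∀ l → σ (w⁻ l) ≢ β l

  avoids : (Fin d → Fin q) → (Fin m → Fin q) → Bool
  avoids β σ = all (λ l → not (isYes (σ (w⁻ l) ≟ β l))) (allFin d)

  avoids-cong : ∀ β {σ σ′} → σ ≗ σ′ → avoids β σ ≡ avoids β σ′
  avoids-cong β σ≗σ′ =
    all-cong (λ l → ≡.cong (λ a → not (isYes (a ≟ β l))) (σ≗σ′ (w⁻ l))) (allFin d)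

  coloringAvoiding : (Fin d → Fin q) → (Fin m → Fin q) → Bool
  coloringAvoiding β σ = isColoring A⁻ τ⁻ σ ∧ avoids β σ

  T-coloringAvoiding : ∀ β σ →
                       T (coloringAvoiding β σ) ⇔ ((IsProper A⁻ σ × Agrees τ⁻ σ) × Avoids β σ)
  T-coloringAvoiding β σ = ⇔-trans T-∧ (T-isColoring A⁻ τ⁻ σ ×-⇔ T-avoids)
    where
    T-avoids : T (avoids β σ) ⇔ Avoids β σ
    T-avoids = mk⇔ (λ t l → toWitnessFalse (Equivalence.to (T-all-allFin _) t l))
                   (λ h → Equivalence.from (T-all-allFin _) (λ l → fromWitnessFalse (h l)))

  coloringAvoiding-cong : ∀ β {σ σ′} → σ ≗ σ′ →
                          coloringAvoiding β σ ≡ coloringAvoiding β σ′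
  coloringAvoiding-cong β σ≗σ′ =
    ≡.cong₂ _∧_ (isColoring-cong A⁻ τ⁻ σ≗σ′) (avoids-cong β σ≗σ′)

  ZAvoiding : {c ℓ : Level} (S : CommutativeSemiring c ℓ) →
              (Fin q → CommutativeSemiring.Carrier S) → (Fin d → Fin q) → CommutativeSemiring.Carrier S
  ZAvoiding S λs β = sumMaps m (weightIf λs (coloringAvoiding β))
    where open Sums S

  module _ (β : Fin d → Fin q) (c : Fin q) (β≡c : ∀ l → β l ≡ c) where

    centre-free : ∀ {σ} → Avoids β σ → ∀ y → A v (punchIn v y) ≡ true → σ y ≢ c
    centre-free {σ} avoid y vy σy≡c =
      let l , w⁻l≡y = neighbor⁻ y vy in
      avoid l (≡.trans (≡.cong σ w⁻l≡y) (≡.trans σy≡c (≡.sym (β≡c l))))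

    module _ (σ : Fin m → Fin q) where

      private
        σ̂-v : insertAt σ v c v ≡ c
        σ̂-v = insertAt-lookup σ v c
        σ̂-off : ∀ x → insertAt σ v c (punchIn v x) ≡ σ x
        σ̂-off = insertAt-punchIn σ v c

      proper-insertAt : IsProper A (insertAt σ v c) ⇔ (IsProper A⁻ σ × Avoids β σ)
      proper-insertAt = mk⇔ to from
        where
        to : IsProper A (insertAt σ v c) → IsProper A⁻ σ × Avoids β σ
        to proper =
          (λ x y xy σx≡σy →
             proper _ _ xy (≡.trans (σ̂-off x) (≡.trans σx≡σy (≡.sym (σ̂-off y))))) ,
          (λ l σw⁻l≡βl → proper v (w l) (nb l) (begin
            insertAt σ v c v                  ≡⟨ σ̂-v ⟩
            c                                 ≡⟨ β≡c l ⟨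
            β l                               ≡⟨ σw⁻l≡βl ⟨
            σ (w⁻ l)                          ≡⟨ σ̂-off (w⁻ l) ⟨
            insertAt σ v c (punchIn v (w⁻ l)) ≡⟨ ≡.cong (insertAt σ v c) (punchIn-w⁻ l) ⟩
            insertAt σ v c (w l)              ∎))
          where open ≡.≡-Reasoning
        from : IsProper A⁻ σ × Avoids β σ → IsProper A (insertAt σ v c)
        from (proper , avoid) x y xy with punchInView v x | punchInView v y
        ... | at     | at     = ⊥-elim (nbr≢ simple xy ≡.refl)
        ... | at     | off y′ = λ σ̂v≡σ̂y′ →
          centre-free avoid y′ xy (≡.trans (≡.sym (σ̂-off y′)) (≡.trans (≡.sym σ̂v≡σ̂y′) σ̂-v))
        ... | off x′ | at     = λ σ̂x′≡σ̂v →
          centre-free avoid x′ (≡.trans (IsSimple.symm simple v _) xy)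
                      (≡.trans (≡.sym (σ̂-off x′)) (≡.trans σ̂x′≡σ̂v σ̂-v))
        ... | off x′ | off y′ = λ σ̂x′≡σ̂y′ →
          proper x′ y′ xy (≡.trans (≡.sym (σ̂-off x′)) (≡.trans σ̂x′≡σ̂y′ (σ̂-off y′)))

      agrees-insertAt : Agrees τ (insertAt σ v c) ⇔ Agrees τ⁻ σ
      agrees-insertAt = mk⇔
        (λ agrees x a τx≡a → ≡.trans (≡.sym (σ̂-off x)) (agrees _ a τx≡a))
        from
        where
        from : Agrees τ⁻ σ → Agrees τ (insertAt σ v c)
        from agrees x a τx≡a with punchInView v x
        ... | at     = case ≡.trans (≡.sym τv) τx≡a of λ ()
        ... | off x′ = ≡.trans (σ̂-off x′) (agrees x′ a τx≡a)

      isColoring-insertAt : isColoring A τ (insertAt σ v c) ≡ coloringAvoiding β σ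
      isColoring-insertAt = T-injective (⇔-trans (T-isColoring A τ (insertAt σ v c))
        (⇔-trans (mk⇔ to from) (⇔-sym (T-coloringAvoiding β σ))))
        where
        to : IsProper A (insertAt σ v c) × Agrees τ (insertAt σ v c) →
             (IsProper A⁻ σ × Agrees τ⁻ σ) × Avoids β σ
        to (proper , agrees) = let proper⁻ , avoid = Equivalence.to proper-insertAt proper in
                               (proper⁻ , Equivalence.to agrees-insertAt agrees) , avoid
        from : (IsProper A⁻ σ × Agrees τ⁻ σ) × Avoids β σ →
               IsProper A (insertAt σ v c) × Agrees τ (insertAt σ v c)
        from ((proper⁻ , agrees⁻) , avoid) =
          Equivalence.from proper-insertAt (proper⁻ , avoid) , Equivalence.from agrees-insertAt agrees⁻

    ZAt-centre : {s ℓ : Level} (S : CommutativeSemiring s ℓ)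
                 (λs : Fin q → CommutativeSemiring.Carrier S) →
                 let open CommutativeSemiring S in ZAt S A τ λs v c ≈ λs c * ZAvoiding S λs β
    ZAt-centre S λs = begin
      ZAt S A τ λs v c
        ≈⟨ Σl-colorings (λ σ → isYes (σ v ≟ c)) ⟩
      sumMaps (suc m) (weightIf λs centreIs-c)
        ≈⟨ sumMaps-fix v c (weightIf-cong λs centreIs-c centreIs-c-cong) centreIs-c-vanishes ⟩
      sumMaps m (weightIf λs centreIs-c ∘ ins)
        ≈⟨ sumMaps-cong m centreIs-c-insertAt ⟩
      sumMaps m (λ σ → λs c * avoidingWeight σ)
        ≈⟨ *-distribˡ-sumMaps (λs c) m avoidingWeight ⟨
      λs c * ZAvoiding S λs β ∎
      where
      open CommutativeSemiring S hiding (zero)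
      open Sums S
      open ColoringSums S A τ λs
      open import Relation.Binary.Reasoning.Setoid setoid
      centreIs-c : (Fin (suc m) → Fin q) → Bool
      centreIs-c σ = isColoring A τ σ ∧ isYes (σ v ≟ c)
      centreIs-c-cong : ∀ {σ σ′} → σ ≗ σ′ → centreIs-c σ ≡ centreIs-c σ′
      centreIs-c-cong σ≗σ′ =
        ≡.cong₂ _∧_ (isColoring-cong A τ σ≗σ′) (≡.cong (λ a → isYes (a ≟ c)) (σ≗σ′ v))
      centreIs-c-vanishes : ∀ σ → σ v ≢ c → weightIf λs centreIs-c σ ≈ 0#
      centreIs-c-vanishes σ σv≢c = weightIf-false λs centreIs-c
        (≡.trans (≡.cong (isColoring A τ σ ∧_) (isYes-false (σ v ≟ c) σv≢c)) (∧-zeroʳ _))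
      ins : (Fin m → Fin q) → Fin (suc m) → Fin q
      ins σ = insertAt σ v c
      avoidingWeight : (Fin m → Fin q) → Carrier
      avoidingWeight = weightIf λs (coloringAvoiding β)
      centreIs-c-insertAt : ∀ σ → weightIf λs centreIs-c (ins σ) ≈ λs c * avoidingWeight σ
      centreIs-c-insertAt σ = begin
        weightIf λs centreIs-c (ins σ)
          ≡⟨ ≡.cong (λ b → if b then weight S λs (ins σ) else 0#)
               (≡.trans (≡.cong₂ _∧_ (isColoring-insertAt σ)
                                     (isYes-true (ins σ v ≟ c) (insertAt-lookup σ v c)))
                        (∧-identityʳ _)) ⟩
        (if coloringAvoiding β σ then weight S λs (ins σ) else 0#)
          ≈⟨ if-*ˡ (coloringAvoiding β σ) (weight-insertAt λs σ v c) ⟩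
        λs c * avoidingWeight σ ∎

  simple⁻ : IsSimple A⁻
  simple⁻ = record { irrefl = λ x → IsSimple.irrefl simple (punchIn v x)
                   ; symm   = λ x y → IsSimple.symm simple (punchIn v x) (punchIn v y) }

  deg-punchIn : ∀ x → deg A (punchIn v x) ≡ (if A (punchIn v x) v then 1 else 0) ℕ.+ deg A⁻ x
  deg-punchIn x = begin
    deg A (punchIn v x)
      ≡⟨ deg≡sum A (punchIn v x) ⟩
    sum (λ y → if A (punchIn v x) y then 1 else 0)
      ≡⟨ sum-remove {i = v} (λ y → if A (punchIn v x) y then 1 else 0) ⟩
    (if A (punchIn v x) v then 1 else 0) ℕ.+ sum (λ y → if A⁻ x y then 1 else 0)
      ≡⟨ ≡.cong ((if A (punchIn v x) v then 1 else 0) ℕ.+_) (deg≡sum A⁻ x) ⟨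
    (if A (punchIn v x) v then 1 else 0) ℕ.+ deg A⁻ x ∎
    where
    open ≡.≡-Reasoning
    open Sums ℕS using (sum; sum-remove)

  module _ (pc : IsPartiallyColored A τ) (w-injective : Injective _≡_ _≡_ w)
           {Δ : ℕ} (deg≤Δ : ∀ x → deg A x ≤ Δ) (Δ<q : suc Δ ≤ q)
           (β : Fin d → Fin q) (β-good : ∀ l → Good A τ v (β l)) where

    private
      w⁻-injective : Injective _≡_ _≡_ w⁻
      w⁻-injective {l} {l′} w⁻l≡w⁻l′ =
        w-injective (≡.trans (≡.sym (punchIn-w⁻ l))
                             (≡.trans (≡.cong (punchIn v) w⁻l≡w⁻l′) (punchIn-w⁻ l′)))

      forbiddenAt : Fin m → List (Fin q)
      forbiddenAt x with any? (λ l → w⁻ l ≟ x)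
      ... | yes (l , _) = β l ∷ []
      ... | no _        = []

      β∈forbiddenAt : ∀ l → β l ∈ forbiddenAt (w⁻ l)
      β∈forbiddenAt l with any? (λ l′ → w⁻ l′ ≟ w⁻ l)
      ... | yes (l′ , w⁻l′≡w⁻l) = here (≡.cong β (w⁻-injective (≡.sym w⁻l′≡w⁻l)))
      ... | no ∄l′              = ⊥-elim (∄l′ (l , ≡.refl))

      |forbiddenAt|≤ : ∀ x → List.length (forbiddenAt x) ≤ (if A (punchIn v x) v then 1 else 0)
      |forbiddenAt|≤ x with any? (λ l → w⁻ l ≟ x)
      ... | no _              = z≤n
      ... | yes (l , w⁻l≡x) = ≤-reflexive (≡.cong (λ b → if b then 1 else 0) (≡.sym (begin
        A (punchIn v x) v    ≡⟨ IsSimple.symm simple _ v ⟩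
        A v (punchIn v x)    ≡⟨ ≡.cong (A v ∘ punchIn v) w⁻l≡x ⟨
        A v (punchIn v (w⁻ l)) ≡⟨ ≡.cong (A v) (punchIn-w⁻ l) ⟩
        A v (w l)            ≡⟨ nb l ⟩
        true                 ∎)))
        where open ≡.≡-Reasoning

    open GreedyColoring A⁻ simple⁻ forbiddenAt

    private
      consistent : Consistent τ⁻
      consistent = proper , allowed
        where
        proper : ∀ x y a b → A⁻ x y ≡ true → τ⁻ x ≡ just a → τ⁻ y ≡ just b → a ≢ b
        proper x y a b xy τx≡a τy≡b a≡b with IsPartiallyColored.edgeOK pc _ _ xy
        ... | inj₁ τx≢τy            =
          τx≢τy (≡.trans τx≡a (≡.trans (≡.cong just a≡b) (≡.sym τy≡b)))
        ... | inj₂ (τx≡nothing , _) = case ≡.trans (≡.sym τx≡nothing) τx≡a of λ ()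
        allowed : ∀ x a → τ⁻ x ≡ just a → a ∉ forbiddenAt x
        allowed x a τx≡a with any? (λ l → w⁻ l ≟ x)
        ... | no _              = λ ()
        ... | yes (l , w⁻l≡x) = λ { (here a≡βl) → β-good l (w l) (nb l)
          (≡.trans (≡.cong τ (≡.trans (≡.sym (punchIn-w⁻ l)) (≡.cong (punchIn v) w⁻l≡x)))
                   (≡.trans τx≡a (≡.cong just a≡βl))) }

      room : HasRoom τ⁻
      room x _ = ≤-trans (s≤s (begin
        List.length (forbiddenAt x) ℕ.+ deg A⁻ x
          ≤⟨ +-monoˡ-≤ (deg A⁻ x) (|forbiddenAt|≤ x) ⟩
        (if A (punchIn v x) v then 1 else 0) ℕ.+ deg A⁻ x
          ≡⟨ deg-punchIn x ⟨
        deg A (punchIn v x)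
          ≤⟨ deg≤Δ (punchIn v x) ⟩
        Δ ∎)) Δ<q
        where open ≤-Reasoning

    coloringAvoiding-exists : ∃ λ σ → T (coloringAvoiding β σ)
    coloringAvoiding-exists =
      let σ , proper , agrees , allowed = greedy (allFin m) τ⁻ consistent room (λ x _ → ∈-allFin x) in
      σ , Equivalence.from (T-coloringAvoiding β σ) ((proper , agrees) , λ l σw⁻l≡βl →
            allowed (w⁻ l) (≡.subst (_∈ forbiddenAt (w⁻ l)) (≡.sym σw⁻l≡βl) (β∈forbiddenAt l)))

    ZAvoiding-positive : 0 < ZAvoiding ℕS ones β
    ZAvoiding-positive = let σ , t = coloringAvoiding-exists in begin-strict
      0
        <⟨ s≤s z≤n ⟩
      1
        ≡⟨ weight-ones σ ⟨
      weight ℕS ones σ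
        ≡⟨ ≡.cong (λ b → if b then weight ℕS ones σ else 0) (Equivalence.to T-≡ t) ⟨
      weightIf ones (coloringAvoiding β) σ
        ≤⟨ term≤sumMaps m (weightIf-cong ones (coloringAvoiding β) (coloringAvoiding-cong β)) σ ⟩
      ZAvoiding ℕS ones β ∎
      where
      open ≤-Reasoning
      open Sums ℕS using (weightIf; weightIf-cong)

-- The graphs G_k

data SplitAtView (m e : ℕ) : Fin (m ℕ.+ e) → Set where
  left  : (x : Fin m) → SplitAtView m e (x ↑ˡ e)
  right : (l : Fin e) → SplitAtView m e (m ↑ʳ l)

splitAtView : ∀ m {e} (a : Fin (m ℕ.+ e)) → SplitAtView m e a
splitAtView m a with splitAt m a in eq
... | inj₁ x = ≡.subst (SplitAtView m _) (splitAt⁻¹-↑ˡ eq) (left x)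
... | inj₂ l = ≡.subst (SplitAtView m _) (splitAt⁻¹-↑ʳ eq) (right l)

module Splitting {m q e : ℕ} (A : Graph (suc m)) (τ : Pinning q (suc m)) (simple : IsSimple A)
                 (v : Fin (suc m)) (τv : τ v ≡ nothing)
                 (w : Fin (suc e) → Fin (suc m)) (nb : ∀ l → A v (w l) ≡ true)
                 (onto : ∀ u → A v u ≡ true → ∃ λ l → w l ≡ u)
                 (i j : Fin q) (k : Fin (suc e)) where

  open Deletion A τ simple v τv w nb onto

  Aₖ : Graph (m ℕ.+ e)
  Aₖ = adjGk A v w k

  τₖ : Pinning q (m ℕ.+ e)
  τₖ = τGk τ v k i j

  wₖ : Fin (m ℕ.+ e)
  wₖ = oldIdx v k (w k) (nbr≢ simple (nb k))

  pinned : Fin e → Fin q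
  pinned l = if isYes (punchIn k l Fin.<? k) then i else j

  private
    kind-↑ˡ : ∀ x → kind v k (x ↑ˡ e) ≡ inj₁ (punchIn v x)
    kind-↑ˡ x rewrite splitAt-↑ˡ m x e = ≡.refl

    kind-↑ʳ : ∀ l → kind v k (m ↑ʳ l) ≡ inj₂ (punchIn k l)
    kind-↑ʳ l rewrite splitAt-↑ʳ m e l = ≡.refl

    Aₖ-old-old : ∀ x y → Aₖ (x ↑ˡ e) (y ↑ˡ e) ≡ A⁻ x y
    Aₖ-old-old x y = ≡.cong₂ (adjKind w A) (kind-↑ˡ x) (kind-↑ˡ y)

    Aₖ-old-copy : ∀ x l → Aₖ (x ↑ˡ e) (m ↑ʳ l) ≡ isYes (punchIn v x ≟ w (punchIn k l))
    Aₖ-old-copy x l = ≡.cong₂ (adjKind w A) (kind-↑ˡ x) (kind-↑ʳ l)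

    Aₖ-copy-old : ∀ l x → Aₖ (m ↑ʳ l) (x ↑ˡ e) ≡ isYes (punchIn v x ≟ w (punchIn k l))
    Aₖ-copy-old l x = ≡.cong₂ (adjKind w A) (kind-↑ʳ l) (kind-↑ˡ x)

    Aₖ-copy-copy : ∀ l l′ → Aₖ (m ↑ʳ l) (m ↑ʳ l′) ≡ false
    Aₖ-copy-copy l l′ = ≡.cong₂ (adjKind w A) (kind-↑ʳ l) (kind-↑ʳ l′)

    τₖ-old : ∀ x → τₖ (x ↑ˡ e) ≡ τ⁻ x
    τₖ-old x = ≡.cong (pinKind τ k i j) (kind-↑ˡ x)

    τₖ-copy : ∀ l → τₖ (m ↑ʳ l) ≡ just (pinned l)
    τₖ-copy l = ≡.trans (≡.cong (pinKind τ k i j) (kind-↑ʳ l))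
                        (≡.sym (if-float just (isYes (punchIn k l Fin.<? k))))

    copy-neighbor : ∀ x l → isYes (punchIn v x ≟ w (punchIn k l)) ≡ true → x ≡ w⁻ (punchIn k l)
    copy-neighbor x l adj = punchIn-injective v _ _
      (≡.trans (toWitness (Equivalence.from T-≡ adj)) (≡.sym (punchIn-w⁻ (punchIn k l))))

  CopiesAvoided : (Fin m → Fin q) → (Fin e → Fin q) → Set
  CopiesAvoided σ₁ σ₂ = ∀ l → σ₁ (w⁻ (punchIn k l)) ≢ σ₂ l

  module _ (σ₁ : Fin m → Fin q) (σ₂ : Fin e → Fin q) where

    private
      σ-old : ∀ x → (σ₁ ++ σ₂) (x ↑ˡ e) ≡ σ₁ x
      σ-old = lookup-++ˡ σ₁ σ₂
      σ-copy : ∀ l → (σ₁ ++ σ₂) (m ↑ʳ l) ≡ σ₂ l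
      σ-copy = lookup-++ʳ σ₁ σ₂

    proper-++ : IsProper Aₖ (σ₁ ++ σ₂) ⇔ (IsProper A⁻ σ₁ × CopiesAvoided σ₁ σ₂)
    proper-++ = mk⇔ to from
      where
      to : IsProper Aₖ (σ₁ ++ σ₂) → IsProper A⁻ σ₁ × CopiesAvoided σ₁ σ₂
      to proper =
        (λ x y xy σx≡σy → proper _ _ (≡.trans (Aₖ-old-old x y) xy)
                            (≡.trans (σ-old x) (≡.trans σx≡σy (≡.sym (σ-old y))))) ,
        (λ l σ₁w≡σ₂l → proper _ _
                            (≡.trans (Aₖ-old-copy _ l) (isYes-true (_ ≟ _) (punchIn-w⁻ (punchIn k l))))
                            (≡.trans (σ-old _) (≡.trans σ₁w≡σ₂l (≡.sym (σ-copy l)))))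
      from : IsProper A⁻ σ₁ × CopiesAvoided σ₁ σ₂ → IsProper Aₖ (σ₁ ++ σ₂)
      from (proper , avoided) a b ab with splitAtView m a | splitAtView m b
      ... | left x  | left y  = λ σa≡σb →
        proper x y (≡.trans (≡.sym (Aₖ-old-old x y)) ab)
                   (≡.trans (≡.sym (σ-old x)) (≡.trans σa≡σb (σ-old y)))
      ... | left x  | right l = λ σa≡σb → avoided l (begin
        σ₁ (w⁻ (punchIn k l))  ≡⟨ ≡.cong σ₁ (copy-neighbor x l (≡.trans (≡.sym (Aₖ-old-copy x l)) ab))
                                ⟨
        σ₁ x                   ≡⟨ σ-old x ⟨
        (σ₁ ++ σ₂) (x ↑ˡ e)    ≡⟨ σa≡σb ⟩
        (σ₁ ++ σ₂) (m ↑ʳ l)    ≡⟨ σ-copy l ⟩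
        σ₂ l                   ∎)
        where open ≡.≡-Reasoning
      ... | right l | left x  = λ σa≡σb → avoided l (begin
        σ₁ (w⁻ (punchIn k l))  ≡⟨ ≡.cong σ₁ (copy-neighbor x l (≡.trans (≡.sym (Aₖ-copy-old l x)) ab))
                                ⟨
        σ₁ x                   ≡⟨ σ-old x ⟨
        (σ₁ ++ σ₂) (x ↑ˡ e)    ≡⟨ σa≡σb ⟨
        (σ₁ ++ σ₂) (m ↑ʳ l)    ≡⟨ σ-copy l ⟩
        σ₂ l                   ∎)
        where open ≡.≡-Reasoning
      ... | right l | right l′ = case ≡.trans (≡.sym (Aₖ-copy-copy l l′)) ab of λ ()

    agrees-++ : Agrees τₖ (σ₁ ++ σ₂) ⇔ (Agrees τ⁻ σ₁ × σ₂ ≗ pinned)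
    agrees-++ = mk⇔ to from
      where
      to : Agrees τₖ (σ₁ ++ σ₂) → Agrees τ⁻ σ₁ × σ₂ ≗ pinned
      to agrees =
        (λ x a τx≡a → ≡.trans (≡.sym (σ-old x)) (agrees _ a (≡.trans (τₖ-old x) τx≡a))) ,
        (λ l → ≡.trans (≡.sym (σ-copy l)) (agrees _ _ (τₖ-copy l)))
      from : Agrees τ⁻ σ₁ × σ₂ ≗ pinned → Agrees τₖ (σ₁ ++ σ₂)
      from (agrees , σ₂≗pinned) a c τa≡c with splitAtView m a
      ... | left x  = ≡.trans (σ-old x) (agrees x c (≡.trans (≡.sym (τₖ-old x)) τa≡c))
      ... | right l = ≡.trans (σ-copy l) (≡.trans (σ₂≗pinned l)
                        (just-injective (≡.trans (≡.sym (τₖ-copy l)) τa≡c)))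

  isColoring-++-unpinned : ∀ σ₁ σ₂ l → σ₂ l ≢ pinned l →
                           isColoring Aₖ τₖ (σ₁ ++ σ₂) ≡ false
  isColoring-++-unpinned σ₁ σ₂ l σ₂l≢pinned = T-injective (mk⇔ unpinned-impossible λ ())
    where
    unpinned-impossible : T (isColoring Aₖ τₖ (σ₁ ++ σ₂)) → T false
    unpinned-impossible t =
      let _ , agrees = Equivalence.to (T-isColoring Aₖ τₖ (σ₁ ++ σ₂)) t in
      σ₂l≢pinned (proj₂ (Equivalence.to (agrees-++ σ₁ σ₂) agrees) l)

  module _ (β : Fin (suc e) → Fin q) (c : Fin q) (βk≡c : β k ≡ c)
           (β-copies : ∀ l → β (punchIn k l) ≡ pinned l) where

    isColoring-++-pinned : ∀ σ → isColoring Aₖ τₖ (σ ++ pinned) ∧ not (isYes ((σ ++ pinned) wₖ ≟ c))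
                                 ≡ coloringAvoiding β σ
    isColoring-++-pinned σ = T-injective
      (⇔-trans T-∧ (⇔-trans (T-isColoring Aₖ τₖ (σ ++ pinned) ×-⇔ T-wₖ)
                            (⇔-trans (mk⇔ to from) (⇔-sym (T-coloringAvoiding β σ)))))
      where
      σ-wₖ : (σ ++ pinned) wₖ ≡ σ (w⁻ k)
      σ-wₖ = lookup-++ˡ σ pinned (w⁻ k)
      T-wₖ : T (not (isYes ((σ ++ pinned) wₖ ≟ c))) ⇔ σ (w⁻ k) ≢ c
      T-wₖ = mk⇔ (λ t → toWitnessFalse t ∘ ≡.trans σ-wₖ)
                 (λ h → fromWitnessFalse (h ∘ ≡.trans (≡.sym σ-wₖ)))
      to : (IsProper Aₖ (σ ++ pinned) × Agrees τₖ (σ ++ pinned)) × σ (w⁻ k) ≢ c →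
           (IsProper A⁻ σ × Agrees τ⁻ σ) × Avoids β σ
      to ((proper , agrees) , σw⁻k≢c) =
        let proper⁻ , copies = Equivalence.to (proper-++ σ pinned) proper
            agrees⁻ , _      = Equivalence.to (agrees-++ σ pinned) agrees
        in (proper⁻ , agrees⁻) , avoid copies σw⁻k≢c
        where
        avoid : CopiesAvoided σ pinned → σ (w⁻ k) ≢ c → Avoids β σ
        avoid copies σw⁻k≢c l with punchInView k l
        ... | at     = λ eq → σw⁻k≢c (≡.trans eq βk≡c)
        ... | off l′ = λ eq → copies l′ (≡.trans eq (β-copies l′))
      from : (IsProper A⁻ σ × Agrees τ⁻ σ) × Avoids β σ →
             (IsProper Aₖ (σ ++ pinned) × Agrees τₖ (σ ++ pinned)) × σ (w⁻ k) ≢ c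
      from ((proper⁻ , agrees⁻) , avoid) =
        ( Equivalence.from (proper-++ σ pinned)
            (proper⁻ , λ l′ eq → avoid (punchIn k l′) (≡.trans eq (≡.sym (β-copies l′))))
        , Equivalence.from (agrees-++ σ pinned) (agrees⁻ , λ _ → ≡.refl) )
        , λ eq → avoid k (≡.trans eq (≡.sym βk≡c))

    Z-Gk : {s ℓ : Level} (S : CommutativeSemiring s ℓ) (λs : Fin q → CommutativeSemiring.Carrier S) →
           let open CommutativeSemiring S in
           Z S Aₖ τₖ λs ≈ ZAt S Aₖ τₖ λs wₖ c + weight S λs pinned * ZAvoiding S λs β
    Z-Gk S λs = trans (Z≈ZAt+sumMaps wₖ c) (+-congˡ (begin
      sumMaps (m ℕ.+ e) (weightIf λs wₖ-not-c)
        ≈⟨ sumMaps-++ m wₖ-not-c-cong ⟩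
      sumMaps m (λ σ₁ → sumMaps e (λ σ₂ → weightIf λs wₖ-not-c (σ₁ ++ σ₂)))
        ≈⟨ sumMaps-cong m (λ σ₁ → sumMaps-pin e pinned
             (wₖ-not-c-cong ∘ ++-cong σ₁ σ₁ (λ _ → ≡.refl)) (unpinned-vanishes σ₁)) ⟩
      sumMaps m (λ σ₁ → weightIf λs wₖ-not-c (σ₁ ++ pinned))
        ≈⟨ sumMaps-cong m pinned-weight ⟩
      sumMaps m (λ σ₁ → weight S λs pinned * weightIf λs (coloringAvoiding β) σ₁)
        ≈⟨ *-distribˡ-sumMaps (weight S λs pinned) m _ ⟨
      weight S λs pinned * ZAvoiding S λs β ∎))
      where
      open CommutativeSemiring S hiding (zero)
      open Sums S
      open ColoringSums S Aₖ τₖ λs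
      open import Relation.Binary.Reasoning.Setoid setoid
      wₖ-not-c : (Fin (m ℕ.+ e) → Fin q) → Bool
      wₖ-not-c σ = isColoring Aₖ τₖ σ ∧ not (isYes (σ wₖ ≟ c))
      wₖ-not-c-cong : weightIf λs wₖ-not-c Preserves _≗_ ⟶ _≈_
      wₖ-not-c-cong = weightIf-cong λs wₖ-not-c (λ σ≗σ′ →
        ≡.cong₂ _∧_ (isColoring-cong Aₖ τₖ σ≗σ′)
                    (≡.cong (λ a → not (isYes (a ≟ c))) (σ≗σ′ wₖ)))
      unpinned-vanishes : ∀ σ₁ σ₂ l → σ₂ l ≢ pinned l → weightIf λs wₖ-not-c (σ₁ ++ σ₂) ≈ 0#
      unpinned-vanishes σ₁ σ₂ l σ₂l≢pinned = weightIf-false λs wₖ-not-c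
        (≡.cong (_∧ not (isYes ((σ₁ ++ σ₂) wₖ ≟ c))) (isColoring-++-unpinned σ₁ σ₂ l σ₂l≢pinned))
      pinned-weight : ∀ σ₁ → weightIf λs wₖ-not-c (σ₁ ++ pinned) ≈
                             weight S λs pinned * weightIf λs (coloringAvoiding β) σ₁
      pinned-weight σ₁ = trans
        (reflexive (≡.cong (λ b → if b then weight S λs (σ₁ ++ pinned) else 0#)
                           (isColoring-++-pinned σ₁)))
        (if-*ˡ (coloringAvoiding β σ₁) (trans (weight-++ λs σ₁ pinned) (*-comm _ _)))

-- The boundary colors β_t and the telescoping product

boundary : {q d : ℕ} (i j : Fin q) → ℕ → Fin d → Fin q
boundary i j t l = if isYes (toℕ l ℕ.<? t) then i else j

module _ {q d : ℕ} (i j : Fin q) where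

  boundary-below : ∀ t (l : Fin d) → toℕ l < t → boundary i j t l ≡ i
  boundary-below t l l<t = ≡.cong (λ b → if b then i else j) (isYes-true (toℕ l ℕ.<? t) l<t)

  boundary-above : ∀ t (l : Fin d) → ¬ toℕ l < t → boundary i j t l ≡ j
  boundary-above t l l≮t = ≡.cong (λ b → if b then i else j) (isYes-false (toℕ l ℕ.<? t) l≮t)

  boundary-suc : ∀ t (l : Fin d) → toℕ l ≢ t → boundary i j (suc t) l ≡ boundary i j t l
  boundary-suc t l l≢t = ≡.cong (λ b → if b then i else j) (T-injective (mk⇔
    (λ l<1+t → fromWitness (≤∧≢⇒< (m<1+n⇒m≤n (toWitness l<1+t)) l≢t))
    (λ l<t → fromWitness (m<n⇒m<1+n (toWitness l<t)))))

  boundary-good : ∀ {n} {A : Graph n} {τ : Pinning q n} {v} → Good A τ v i → Good A τ v j →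
                  ∀ t (l : Fin d) → Good A τ v (boundary i j t l)
  boundary-good Γi Γj t l with isYes (toℕ l ℕ.<? t)
  ... | true  = Γi
  ... | false = Γj

module _ {m q : ℕ} (A : Graph (suc m)) (τ : Pinning q (suc m)) (simple : IsSimple A)
         (v : Fin (suc m)) (τv : τ v ≡ nothing) where

  Gk-factors : ∀ {d} (w : Fin d → Fin (suc m)) (nb : ∀ l → A v (w l) ≡ true)
               (onto : ∀ u → A v u ≡ true → ∃ λ l → w l ≡ u) (i j : Fin q)
               {r ℓ : Level} (R : CommutativeRing r ℓ) (λs : Fin q → CommutativeRing.Carrier R)
               (k : Fin d) →
    let open CommutativeRing R
        open Deletion A τ simple v τv w nb onto
        Zₖ = Z commutativeSemiring (adjGk A v w k) (τGk τ v k i j) λs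
        ZAtₖ = ZAt commutativeSemiring (adjGk A v w k) (τGk τ v k i j) λs
                   (oldIdx v k (w k) (nbr≢ simple (nb k)))
    in ∃ λ C → (Zₖ - ZAtₖ j ≈ C * ZAvoiding commutativeSemiring λs (boundary i j (toℕ k)))
             × (Zₖ - ZAtₖ i ≈ C * ZAvoiding commutativeSemiring λs (boundary i j (suc (toℕ k))))
  Gk-factors {suc e} w nb onto i j R λs k = weight commutativeSemiring λs pinned ,
    x≈y+z⇒x-y≈z (Z-Gk (boundary i j (toℕ k)) j (boundary-above i j _ k (<-irrefl ≡.refl))
                     (λ _ → ≡.refl) commutativeSemiring λs) ,
    x≈y+z⇒x-y≈z (Z-Gk (boundary i j (suc (toℕ k))) i (boundary-below i j _ k ≤-refl)
                     (λ l → boundary-suc i j _ (punchIn k l) (punchInᵢ≢i k l ∘ toℕ-injective))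
                     commutativeSemiring λs)
    where
    open CommutativeRing R
    open Splitting A τ simple v τv w nb onto i j k
    open import Algebra.Properties.AbelianGroup +-abelianGroup using (//-rightDividesʳ)
    x≈y+z⇒x-y≈z : ∀ {x y z} → x ≈ y + z → x - y ≈ z
    x≈y+z⇒x-y≈z {x} {y} {z} x≈y+z =
      trans (+-congʳ (trans x≈y+z (+-comm y z))) (//-rightDividesʳ y z)

  ZAt-positive : IsPartiallyColored A τ → ∀ {d} (w : Fin d → Fin (suc m)) → Injective _≡_ _≡_ w →
                 (nb : ∀ l → A v (w l) ≡ true) (onto : ∀ u → A v u ≡ true → ∃ λ l → w l ≡ u) →
                 ∀ {c} → Good A τ v c → ∀ {Δ} → (∀ x → deg A x ≤ Δ) → suc Δ ≤ q →
                 0 < ZAt ℕS A τ ones v c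
  ZAt-positive pc w w-injective nb onto {c} Γc deg≤Δ Δ<q = ≡.subst (0 <_)
    (≡.sym (≡.trans (ZAt-centre (λ _ → c) c (λ _ → ≡.refl) ℕS ones) (*-identityˡ _)))
    (ZAvoiding-positive pc w-injective deg≤Δ Δ<q (λ _ → c) (λ _ → Γc))
    where open Deletion A τ simple v τv w nb onto

  ZAtₖ<Zₖ : IsPartiallyColored A τ → ∀ {d} (w : Fin d → Fin (suc m)) → Injective _≡_ _≡_ w →
            (nb : ∀ l → A v (w l) ≡ true) (onto : ∀ u → A v u ≡ true → ∃ λ l → w l ≡ u) →
            ∀ (i j : Fin q) → Good A τ v i → Good A τ v j →
            ∀ {Δ} → (∀ x → deg A x ≤ Δ) → suc Δ ≤ q → (k : Fin d) →
            ZAt ℕS (adjGk A v w k) (τGk τ v k i j) ones (oldIdx v k (w k) (nbr≢ simple (nb k))) j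
              < Z ℕS (adjGk A v w k) (τGk τ v k i j) ones
  ZAtₖ<Zₖ pc {suc e} w w-injective nb onto i j Γi Γj deg≤Δ Δ<q k = begin-strict
    ZAt ℕS Aₖ τₖ ones wₖ j
      <⟨ m<m+n _ pinned-part-positive ⟩
    ZAt ℕS Aₖ τₖ ones wₖ j ℕ.+ weight ℕS ones pinned ℕ.* Y
      ≡⟨ Z-Gk β j (boundary-above i j _ k (<-irrefl ≡.refl)) (λ _ → ≡.refl) ℕS ones ⟨
    Z ℕS Aₖ τₖ ones ∎
    where
    open Deletion A τ simple v τv w nb onto
    open Splitting A τ simple v τv w nb onto i j k
    open ≤-Reasoning
    β : Fin (suc e) → Fin q
    β = boundary i j (toℕ k)
    Y : ℕ
    Y = ZAvoiding ℕS ones β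
    pinned-part-positive : 0 < weight ℕS ones pinned ℕ.* Y
    pinned-part-positive = ≡.subst (λ n → 0 < n ℕ.* Y) (≡.sym (weight-ones pinned))
      (≡.subst (0 <_) (≡.sym (*-identityˡ Y))
        (ZAvoiding-positive pc w-injective deg≤Δ Δ<q β
                            (boundary-good i j {A = A} {τ} {v} Γi Γj (toℕ k))))

  ratio-identity : ∀ {d} (w : Fin d → Fin (suc m)) (nb : ∀ l → A v (w l) ≡ true)
                   (onto : ∀ u → A v u ≡ true → ∃ λ l → w l ≡ u) (i j : Fin q)
                   {r ℓ : Level} (R : CommutativeRing r ℓ) (λs : Fin q → CommutativeRing.Carrier R) →
    let open CommutativeRing R in
    (ZAt commutativeSemiring A τ λs v i * λs j
       * Πl commutativeSemiring (map (λ k →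
           Z commutativeSemiring (adjGk A v w k) (τGk τ v k i j) λs
           - ZAt commutativeSemiring (adjGk A v w k) (τGk τ v k i j) λs
               (oldIdx v k (w k) (nbr≢ simple (nb k))) j)
           (allFin d)))
    ≈
    (ZAt commutativeSemiring A τ λs v j * λs i
       * Πl commutativeSemiring (map (λ k →
           Z commutativeSemiring (adjGk A v w k) (τGk τ v k i j) λs
           - ZAt commutativeSemiring (adjGk A v w k) (τGk τ v k i j) λs
               (oldIdx v k (w k) (nbr≢ simple (nb k))) i)
           (allFin d)))
  ratio-identity {d} w nb onto i j {r} {ℓ} R λs = begin
    ZAt S A τ λs v i * λs j * Πl S (map (F j) (allFin d))
      ≡⟨ ≡.cong (ZAt S A τ λs v i * λs j *_) (Πl-allFin (F j)) ⟩
    ZAt S A τ λs v i * λs j * product (F j)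
      ≈⟨ *-cong (*-congʳ (ZAt-centre (boundary i j d) i (λ l → boundary-below i j d l (toℕ<n l)) S λs))
                (factorised j Yₖ (λ k → proj₁ (proj₂ (Gk-factors w nb onto i j R λs k)))) ⟩
    λs i * Y d * λs j * (product C * product Yₖ)
      ≈⟨ solve 5 (λ a y b p t → ((a ⊕ y) ⊕ b) ⊕ (p ⊕ t) ⊜ ((b ⊕ a) ⊕ p) ⊕ (y ⊕ t)) refl
               (λs i) (Y d) (λs j) (product C) (product Yₖ) ⟩
    λs j * λs i * product C * (Y d * product Yₖ)
      ≈⟨ *-congˡ (sum-telescope *-commutativeMonoid d Y) ⟩
    λs j * λs i * product C * (Y 0 * product Yₖ₊₁)
      ≈⟨ solve 5 (λ b a p y t → ((b ⊕ a) ⊕ p) ⊕ (y ⊕ t) ⊜ ((b ⊕ y) ⊕ a) ⊕ (p ⊕ t)) refl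
               (λs j) (λs i) (product C) (Y 0) (product Yₖ₊₁) ⟩
    λs j * Y 0 * λs i * (product C * product Yₖ₊₁)
      ≈⟨ *-cong (*-congʳ (ZAt-centre (boundary i j 0) j (λ l → boundary-above i j 0 l λ ()) S λs))
                (factorised i Yₖ₊₁ (λ k → proj₂ (proj₂ (Gk-factors w nb onto i j R λs k)))) ⟨
    ZAt S A τ λs v j * λs i * product (F i)
      ≡⟨ ≡.cong (ZAt S A τ λs v j * λs i *_) (Πl-allFin (F i)) ⟨
    ZAt S A τ λs v j * λs i * Πl S (map (F i) (allFin d)) ∎
    where
    open CommutativeRing R
    S : CommutativeSemiring r ℓ
    S = commutativeSemiring
    open Sums S using (product; Πl-allFin; module ∏)
    open Deletion A τ simple v τv w nb onto
    open import Algebra.Solver.CommutativeMonoid *-commutativeMonoid using (solve; _⊕_; _⊜_)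
    open import Relation.Binary.Reasoning.Setoid setoid
    F : Fin q → Fin d → Carrier
    F c k = Z S (adjGk A v w k) (τGk τ v k i j) λs
            - ZAt S (adjGk A v w k) (τGk τ v k i j) λs (oldIdx v k (w k) (nbr≢ simple (nb k))) c
    Y : ℕ → Carrier
    Y t = ZAvoiding S λs (boundary i j t)
    C : Fin d → Carrier
    C k = proj₁ (Gk-factors w nb onto i j R λs k)
    Yₖ Yₖ₊₁ : Fin d → Carrier
    Yₖ   k = Y (toℕ k)
    Yₖ₊₁ k = Y (suc (toℕ k))
    factorised : ∀ c (g : Fin d → Carrier) → (∀ k → F c k ≈ C k * g k) →
                 product (F c) ≈ product C * product g
    factorised c g F≈Cg = trans (∏.sum-cong-≋ F≈Cg) (∏.∑-distrib-+ C g)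

mainTheorem8 : {c ℓ : Level} (R : CommutativeRing c ℓ)
  (n q Δ d : ℕ) (A : Graph n) (τ : Pinning q n)
  (pc : IsPartiallyColored A τ) → MaxDegree A Δ → 1 ≤ Δ → suc Δ ≤ q →
  (v : Fin n) → τ v ≡ nothing → d ≡ deg A v →
  (w : Fin d → Fin n) → Injective _≡_ _≡_ w →
  (nb : ∀ l → A v (w l) ≡ true) → (∀ u → A v u ≡ true → ∃ (λ l → w l ≡ u)) →
  (i j : Fin q) → Good A τ v i → Good A τ v j →
  -- all denominators are nonzero rational functions (positive at λ = 1)
  ( (0 < ZAt ℕS A τ ones v j)
    × (∀ k → ZAt ℕS (adjGk A v w k) (τGk τ v k i j) ones
                 (oldIdx v k (w k) (nbr≢ (IsPartiallyColored.simple pc) (nb k))) j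
             < Z ℕS (adjGk A v w k) (τGk τ v k i j) ones) )
  ×
  -- the identity, cross-multiplied, as a polynomial identity
  (let open CommutativeRing R in
   ∀ (λs : Fin q → Carrier) →
   (ZAt commutativeSemiring A τ λs v i * λs j
      * Πl commutativeSemiring (map (λ k →
          Z commutativeSemiring (adjGk A v w k) (τGk τ v k i j) λs
          - ZAt commutativeSemiring (adjGk A v w k) (τGk τ v k i j) λs
              (oldIdx v k (w k) (nbr≢ (IsPartiallyColored.simple pc) (nb k))) j)
          (allFin d)))
   ≈
   (ZAt commutativeSemiring A τ λs v j * λs i
      * Πl commutativeSemiring (map (λ k →
          Z commutativeSemiring (adjGk A v w k) (τGk τ v k i j) λs
          - ZAt commutativeSemiring (adjGk A v w k) (τGk τ v k i j) λs
              (oldIdx v k (w k) (nbr≢ (IsPartiallyColored.simple pc) (nb k))) i)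
          (allFin d))))
mainTheorem8 R zero q Δ d A τ pc _ _ _ () _ _ _ _ _ _ _ _ _ _
mainTheorem8 R (suc m) q Δ d A τ pc (deg≤Δ , _) _ Δ<q v τv _ w w-injective nb onto i j Γi Γj =
  ( ZAt-positive A τ simple v τv pc w w-injective nb onto Γj deg≤Δ Δ<q
  , ZAtₖ<Zₖ A τ simple v τv pc w w-injective nb onto i j Γi Γj deg≤Δ Δ<q ) ,
  ratio-identity A τ simple v τv w nb onto i j R
  where
  simple : IsSimple A
  simple = IsPartiallyColored.simple pc
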